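{- Let $n$ be a positive integer and let $m=\{14(2n+1)\}^2+2$. Suppose $m$ is square-free. Then the class number $h(m)$ of the real quadratic field $\mathbb{Q}(\sqrt{m})$ satisfies $h(m)>1$.
   Context: For a square-free positive integer $m$, $h(m)$ denotes the class number of the real quadratic field $k_m=\mathbb{Q}(\sqrt{m})$. -}

module Defs where

open import Data.Nat as ℕ using (ℕ; suc; _%_; _/_; _∸_; _^_; _≡ᵇ_)
open import Data.Nat.Divisibility using (_∣_)
open import Data.Integer as ℤ using (ℤ; +_; 0ℤ)
open import Data.Bool using (if_then_else_)
open import Data.Product using (_×_; _,_; Σ; ∃; ∃-syntax)
open import Relation.Binary.PropositionalEquality using (_≡_)
open import Relation.Nullary using (¬_)
open import Level using (0ℓ)

SquareFree : ℕ → Set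
SquareFree m = ∀ d → (d ℕ.* d) ∣ m → d ≡ 1

-- The ring of integers O_m of Q(√m) (m square-free, m > 1) has ℤ-basis 1, ω with
--   ω = (1 + √m)/2  if m ≡ 1 (mod 4), so ω² = ω + (m-1)/4
--   ω = √m          otherwise,        so ω² = m
-- We encode ω² = tω + s.
ωt : ℕ → ℤ
ωt m = if (m % 4) ≡ᵇ 1 then + 1 else 0ℤ

ωs : ℕ → ℤ
ωs m = if (m % 4) ≡ᵇ 1 then + ((m ∸ 1) / 4) else + m

-- element a + bω of O_m
O : ℕ → Set
O m = ℤ × ℤ

zeroO : ∀ m → O m
zeroO m = (0ℤ , 0ℤ)

-- (a + bω)(c + dω) = (ac + s bd) + (ad + bc + t bd) ω
mulO : ∀ m → O m → O m → O m
mulO m (a , b) (c , d) =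
  (a ℤ.* c ℤ.+ ωs m ℤ.* (b ℤ.* d) , a ℤ.* d ℤ.+ b ℤ.* c ℤ.+ ωt m ℤ.* (b ℤ.* d))

addO : ∀ m → O m → O m → O m
addO m (a , b) (c , d) = (a ℤ.+ c , b ℤ.+ d)

record Ideal (m : ℕ) : Set₁ where
  field
    mem      : O m → Set
    has-zero : mem (zeroO m)
    add-closed : ∀ x y → mem x → mem y → mem (addO m x y)
    mul-closed : ∀ r x → mem x → mem (mulO m r x)

open Ideal public

NonzeroIdeal : ∀ {m} → Ideal m → Set
NonzeroIdeal {m} I = Σ (O m) λ x → mem I x × ¬ (x ≡ zeroO m)

Principal : ∀ {m} → Ideal m → Set
Principal {m} I = Σ (O m) λ g →
  ∀ x → (mem I x → Σ (O m) λ r → x ≡ mulO m r g)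
      × (Σ (O m) (λ r → x ≡ mulO m r g) → mem I x)

-- h(m) > 1 : the ideal class group of O_m is nontrivial, i.e. some
-- nonzero ideal of O_m is not principal.
ClassNumberGT1 : ℕ → Set₁
ClassNumberGT1 m = Σ (Ideal m) λ I → NonzeroIdeal I × ¬ Principal I

mOf : ℕ → ℕ
mOf n = (14 ℕ.* (2 ℕ.* n ℕ.+ 1)) ^ 2 ℕ.+ 2

-- Write m = A² + 2 with A = 7a, a ≥ 1. Then m ≢ 1 (mod 4), so O_m = ℤ[√m], and m ≡ 3² (mod 7),
-- so 𝔭 = (7, 3 + √m) is an ideal. It is not principal: a generator g satisfies 7 ∣ N(g)
-- because g ∈ 𝔭, and N(g) ∣ a²·N(7) + N(3 + √m) = 49a² + (7 − 49a²) = 7, so N(g) = ±7.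
-- But x² − m y² = ±7 has no integer solution: multiplying by the unit A² + 1 − A√m strictly
-- decreases |y| as long as |y| ≥ 3, and for |y| ≤ 2 the number m y² ± 7 lies strictly
-- between two consecutive squares (this is where A ≥ 5 is needed).
module Submission where

open import Defs
open import Data.Nat using (ℕ; _≥_)

open import Data.Bool using (false)
open import Data.List using (_∷_; [])
open import Data.Product using (Σ; _×_; _,_; proj₁; proj₂)
open import Data.Sum using (_⊎_; inj₁; inj₂)
open import Function using (case_of_)
open import Relation.Binary.PropositionalEquality
open import Relation.Nullary using (¬_; yes; no)

module _ where
  open import Data.Nat
  open import Data.Nat.DivMod using ([m+kn]%n≡m%n)
  open import Data.Nat.Properties
  open import Data.Nat.Tactic.RingSolver

  n*n+2%4≢1 : ∀ n → ((n * n + 2) % 4 ≡ᵇ 1) ≡ false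
  n*n+2%4≢1 0 = refl
  n*n+2%4≢1 1 = refl
  n*n+2%4≢1 (suc (suc n)) = begin
    ((2 + n) * (2 + n) + 2) % 4 ≡ᵇ 1       ≡⟨ cong (λ t → t % 4 ≡ᵇ 1) expand ⟩
    ((n * n + 2) + (n + 1) * 4) % 4 ≡ᵇ 1   ≡⟨ cong (_≡ᵇ 1) ([m+kn]%n≡m%n (n * n + 2) (n + 1) 4) ⟩
    (n * n + 2) % 4 ≡ᵇ 1                   ≡⟨ n*n+2%4≢1 n ⟩
    false                                  ∎
    where
    open ≡-Reasoning
    expand : (2 + n) * (2 + n) + 2 ≡ (n * n + 2) + (n + 1) * 4
    expand = solve (n ∷ [])

  -- The hypothesis says d < 2k; as an equation, each use below is a ring identity.
  no-square-between : ∀ {x} k d e → 2 * k ≡ d + suc e → x * x ≢ k * k + suc d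
  no-square-between {x} k d e gap x²≡ with x ≤? k
  ... | yes x≤k = <⇒≱ (m<m+n (k * k) z<s) (subst (_≤ k * k) x²≡ (*-mono-≤ x≤k x≤k))
  ... | no  x≰k = <⇒≱ below-next (subst (suc k * suc k ≤_) x²≡ (*-mono-≤ k<x k<x))
    where
    k<x = ≰⇒> x≰k
    below-next : k * k + suc d < suc k * suc k
    below-next = subst (k * k + suc d <_) (sym (begin
      suc k * suc k           ≡⟨ solve (k ∷ []) ⟩
      k * k + (2 * k + 1)     ≡⟨ cong (λ t → k * k + (t + 1)) gap ⟩
      k * k + (d + suc e + 1) ≡⟨ solve (k ∷ d ∷ e ∷ []) ⟩
      k * k + suc d + suc e   ∎)) (m<m+n _ z<s)
      where open ≡-Reasoning

  module _ (b : ℕ) where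
    no-small-solution⁺ : ∀ x y → y < 3 → x * x ≢ ((5 + b) * (5 + b) + 2) * (y * y) + 7
    no-small-solution⁺ x 0 _ eq = no-square-between {x} 2 2 1 refl
      (trans eq (cong (_+ 7) (*-zeroʳ ((5 + b) * (5 + b) + 2))))
    no-small-solution⁺ x 1 _ eq = no-square-between {x} (5 + b) 8 (1 + 2 * b) (solve (b ∷ []))
      (trans eq (solve (b ∷ [])))
    no-small-solution⁺ x 2 _ eq = no-square-between {x} (10 + 2 * b) 14 (5 + 4 * b) (solve (b ∷ []))
      (trans eq (solve (b ∷ [])))
    no-small-solution⁺ _ (suc (suc (suc _))) (s≤s (s≤s (s≤s ())))

    no-small-solution⁻ : ∀ x y → y < 3 → x * x + 7 ≢ ((5 + b) * (5 + b) + 2) * (y * y)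
    no-small-solution⁻ x 0 _ eq =
      case m+n≡0⇒n≡0 (x * x) (trans eq (*-zeroʳ ((5 + b) * (5 + b) + 2))) of λ ()
    no-small-solution⁻ x 1 _ eq = no-square-between {x} (4 + b) (3 + 2 * b) 4 (solve (b ∷ []))
      (+-cancelʳ-≡ 7 _ _ (trans eq (solve (b ∷ []))))
    no-small-solution⁻ x 2 _ eq = no-square-between {x} (10 + 2 * b) 0 (19 + 4 * b) (solve (b ∷ []))
      (+-cancelʳ-≡ 7 _ _ (trans eq (solve (b ∷ []))))
    no-small-solution⁻ _ (suc (suc (suc _))) (s≤s (s≤s (s≤s ())))

  descent-bound : ∀ {A y} x → 1 ≤ A → 3 ≤ y → y * y + A * A * 7 < y * ((A * A + 1) * y + A * x)
  descent-bound {A} {y} x 1≤A 3≤y = begin-strict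
    y * y + A * A * 7         <⟨ +-monoʳ-< (y * y) (*-monoʳ-< (A * A) {{A*A≢0}} 7<y*y) ⟩
    y * y + A * A * (y * y)   ≡⟨ solve (A ∷ y ∷ []) ⟩
    y * ((A * A + 1) * y)     ≤⟨ *-monoʳ-≤ y (m≤m+n _ (A * x)) ⟩
    y * ((A * A + 1) * y + A * x) ∎
    where
    open ≤-Reasoning
    7<y*y : 7 < y * y
    7<y*y = ≤-trans (n≤1+n 8) (*-mono-≤ 3≤y 3≤y)
    A*A≢0 : NonZero (A * A)
    A*A≢0 = >-nonZero (*-mono-≤ 1≤A 1≤A)

  mOf≡[7[4n+2]]²+2 : ∀ n → mOf n ≡ 7 * suc (4 * n + 1) * (7 * suc (4 * n + 1)) + 2
  mOf≡[7[4n+2]]²+2 n = expand n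
    where
    expand : ∀ n → 14 * (2 * n + 1) * (14 * (2 * n + 1) * 1) + 2
                   ≡ 7 * suc (4 * n + 1) * (7 * suc (4 * n + 1)) + 2
    expand = solve-∀

open import Data.Integer using (ℤ; +_; -[1+_]; _+_; _-_; _*_; _⊖_; ∣_∣)
open import Data.Integer.Properties
  using (pos-+; pos-*; +-identityʳ; *-identityˡ; *-zeroʳ; abs-*; ∣i-j∣≤∣i∣+∣j∣; [+m]-[+n]≡m⊖n; ∣⊖∣-≤; ∣m⊖n∣≡∣n⊖m∣)
open import Data.Integer.Divisibility.Signed using (_∣_; divides; ∣-refl; ∣m∣n⇒∣m+n; ∣n⇒∣m*n; ∣m⇒∣m*n; ∣⇒∣ᵤ)
open import Data.Integer.Tactic.RingSolver
open import Data.Nat.Induction using (<-rec)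
import Data.Nat as ℕ
import Data.Nat.Properties as ℕ
import Data.Nat.Divisibility as ℕ

norm : ℤ → ℤ × ℤ → ℤ
norm M (x , y) = x * x - M * (y * y)

-- The ring solver does not unfold norm, hence the expanded identities in the lemmas about it.
norm-* : ∀ M a b c d →
         norm M (a * c + M * (b * d) , a * d + b * c) ≡ norm M (a , b) * norm M (c , d)
norm-* = expanded
  where
  expanded : ∀ M a b c d →
    (a * c + M * (b * d)) * (a * c + M * (b * d)) - M * ((a * d + b * c) * (a * d + b * c))
      ≡ (a * a - M * (b * b)) * (c * c - M * (d * d))
  expanded = solve-∀

+∣i∣*+∣i∣≡i*i : ∀ i → + ∣ i ∣ * + ∣ i ∣ ≡ i * i
+∣i∣*+∣i∣≡i*i (+ n)     = refl
+∣i∣*+∣i∣≡i*i -[1+ n ] = refl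

norm-abs : ∀ M x y → norm M (+ ∣ x ∣ , + ∣ y ∣) ≡ norm M (x , y)
norm-abs M x y = cong₂ (λ u v → u - M * v) (+∣i∣*+∣i∣≡i*i x) (+∣i∣*+∣i∣≡i*i y)

+[n*n+2] : ∀ n → + (n ℕ.* n ℕ.+ 2) ≡ + n * + n + + 2
+[n*n+2] n = trans (pos-+ (n ℕ.* n) 2) (cong (_+ + 2) (pos-* n n))

norm-pos : ∀ m x y → norm (+ m) (+ x , + y) ≡ + (x ℕ.* x) - + (m ℕ.* (y ℕ.* y))
norm-pos m x y = sym (cong₂ (λ u v → u - v) (pos-* x x)
                     (trans (pos-* m (y ℕ.* y)) (cong (+ m *_) (pos-* y y))))

∣+u-+v∣≡k⇒ : ∀ u v {k} → ∣ + u - + v ∣ ≡ k → u ≡ v ℕ.+ k ⊎ u ℕ.+ k ≡ v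
∣+u-+v∣≡k⇒ u v {k} eq = case ℕ.≤-total u v of λ
  { (inj₁ u≤v) → inj₂ (subst (λ t → u ℕ.+ t ≡ v) (trans (sym (∣⊖∣-≤ u≤v)) ∣u⊖v∣≡k)
                         (ℕ.m+[n∸m]≡n u≤v))
  ; (inj₂ v≤u) → inj₁ (sym (subst (λ t → v ℕ.+ t ≡ u) (trans (sym (∣⊖∣-≤ v≤u)) ∣v⊖u∣≡k)
                              (ℕ.m+[n∸m]≡n v≤u))) }
  where
  ∣u⊖v∣≡k : ∣ u ⊖ v ∣ ≡ k
  ∣u⊖v∣≡k = trans (cong ∣_∣ (sym ([+m]-[+n]≡m⊖n u v))) eq
  ∣v⊖u∣≡k : ∣ v ⊖ u ∣ ≡ k
  ∣v⊖u∣≡k = trans (∣m⊖n∣≡∣n⊖m∣ v u) ∣u⊖v∣≡k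

no-small-solution : ∀ {A} → 5 ℕ.≤ A → ∀ x y → y ℕ.< 3 →
                    ∣ norm (+ (A ℕ.* A ℕ.+ 2)) (+ x , + y) ∣ ≢ 7
no-small-solution 5≤A x y y<3 ∣N∣≡7 with ℕ.m≤n⇒∃[o]m+o≡n 5≤A
... | b , refl with ∣+u-+v∣≡k⇒ (x ℕ.* x) _
                      (trans (cong ∣_∣ (sym (norm-pos ((5 ℕ.+ b) ℕ.* (5 ℕ.+ b) ℕ.+ 2) x y))) ∣N∣≡7)
...   | inj₁ eq = no-small-solution⁺ b x y y<3 eq
...   | inj₂ eq = no-small-solution⁻ b x y y<3 eq

norm-unit-invariant : ∀ a x y →
  let M = a * a + + 2 ; E = a * a + + 1 in norm M (E * x - M * a * y , E * y - a * x) ≡ norm M (x , y)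
norm-unit-invariant = expanded
  where
  expanded : ∀ a x y → let M = a * a + + 2 ; E = a * a + + 1 in
    (E * x - M * a * y) * (E * x - M * a * y) - M * ((E * y - a * x) * (E * y - a * x))
      ≡ x * x - M * (y * y)
  expanded = solve-∀

conjugate-product : ∀ a x y → let M = a * a + + 2 ; E = a * a + + 1 in
  (E * y - a * x) * (E * y + a * x) ≡ y * y - a * a * norm M (x , y)
conjugate-product = expanded
  where
  expanded : ∀ a x y → let M = a * a + + 2 ; E = a * a + + 1 in
    (E * y - a * x) * (E * y + a * x) ≡ y * y - a * a * (x * x - M * (y * y))
  expanded = solve-∀

-- X + Y√m = (E − A√m)(x + y√m) with E = A² + 1, a unit of norm E² − mA² = 1; the conjugate
-- product Y · (Ey + Ax) = y² − A²N bounds |Y| below y.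
descend : ∀ {A x y} → 1 ℕ.≤ A → 3 ℕ.≤ y → ∣ norm (+ (A ℕ.* A ℕ.+ 2)) (+ x , + y) ∣ ≡ 7 →
          Σ ℕ λ x′ → Σ ℕ λ y′ → y′ ℕ.< y ×
            norm (+ (A ℕ.* A ℕ.+ 2)) (+ x′ , + y′) ≡ norm (+ (A ℕ.* A ℕ.+ 2)) (+ x , + y)
descend {A} {x} {y} 1≤A 3≤y ∣N∣≡7 = ∣ X ∣ , ∣ Y ∣ , ∣Y∣<y , same-norm
  where
  a E N : ℤ
  a = + A
  E = a * a + + 1
  N = norm (+ (A ℕ.* A ℕ.+ 2)) (+ x , + y)
  X Y : ℤ
  X = E * + x - (a * a + + 2) * a * + y
  Y = E * + y - a * + x

  same-norm : norm (+ (A ℕ.* A ℕ.+ 2)) (+ ∣ X ∣ , + ∣ Y ∣) ≡ N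
  same-norm = trans (norm-abs (+ (A ℕ.* A ℕ.+ 2)) X Y)
    (subst (λ M → norm M (X , Y) ≡ norm M (+ x , + y)) (sym (+[n*n+2] A))
           (norm-unit-invariant a (+ x) (+ y)))

  V : ℕ
  V = (A ℕ.* A ℕ.+ 1) ℕ.* y ℕ.+ A ℕ.* x
  +V : + V ≡ E * + y + a * + x
  +V = trans (pos-+ ((A ℕ.* A ℕ.+ 1) ℕ.* y) (A ℕ.* x)) (cong₂ _+_
         (trans (pos-* (A ℕ.* A ℕ.+ 1) y)
                (cong (_* + y) (trans (pos-+ (A ℕ.* A) 1) (cong (_+ + 1) (pos-* A A)))))
         (pos-* A x))

  Y*V : Y * + V ≡ + y * + y - a * a * N
  Y*V = trans (cong (Y *_) +V)
    (subst (λ M → Y * (E * + y + a * + x) ≡ + y * + y - a * a * norm M (+ x , + y))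
      (sym (+[n*n+2] A)) (conjugate-product a (+ x) (+ y)))

  ∣Y∣<y : ∣ Y ∣ ℕ.< y
  ∣Y∣<y = ℕ.*-cancelʳ-< V ∣ Y ∣ y (begin-strict
    ∣ Y ∣ ℕ.* V                       ≡⟨ abs-* Y (+ V) ⟨
    ∣ Y * + V ∣                       ≡⟨ cong ∣_∣ Y*V ⟩
    ∣ + y * + y - a * a * N ∣         ≤⟨ ∣i-j∣≤∣i∣+∣j∣ (+ y * + y) (a * a * N) ⟩
    ∣ + y * + y ∣ ℕ.+ ∣ a * a * N ∣   ≡⟨ cong₂ ℕ._+_ (abs-* (+ y) (+ y))
                                          (trans (abs-* (a * a) N) (cong₂ ℕ._*_ (abs-* a a) ∣N∣≡7)) ⟩
    y ℕ.* y ℕ.+ A ℕ.* A ℕ.* 7         <⟨ descent-bound x 1≤A 3≤y ⟩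
    y ℕ.* V                           ∎)
    where open ℕ.≤-Reasoning

∣norm∣≢7 : ∀ {A} → 5 ℕ.≤ A → ∀ z → ∣ norm (+ (A ℕ.* A ℕ.+ 2)) z ∣ ≢ 7
∣norm∣≢7 {A} 5≤A (x , y) =
  subst (λ n → ∣ n ∣ ≢ 7) (norm-abs (+ (A ℕ.* A ℕ.+ 2)) x y) (<-rec P step ∣ y ∣ ∣ x ∣)
  where
  P : ℕ → Set
  P y = ∀ x → ∣ norm (+ (A ℕ.* A ℕ.+ 2)) (+ x , + y) ∣ ≢ 7

  step : ∀ y → (∀ {y′} → y′ ℕ.< y → P y′) → P y
  step y rec x ∣N∣≡7 = case y ℕ.<? 3 of λ
    { (yes y<3) → no-small-solution 5≤A x y y<3 ∣N∣≡7
    ; (no y≮3) → case descend {A} {x} {y} (ℕ.≤-trans (ℕ.s≤s ℕ.z≤n) 5≤A) (ℕ.≮⇒≥ y≮3) ∣N∣≡7 of λ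
        { (x′ , y′ , y′<y , same-norm) → rec y′<y x′ (trans (cong ∣_∣ same-norm) ∣N∣≡7) } }

mulO-ℤ[√m] : ∀ {m} → (m ℕ.% 4 ℕ.≡ᵇ 1) ≡ false → ∀ a b c d →
             mulO m (a , b) (c , d) ≡ (a * c + + m * (b * d) , a * d + b * c)
mulO-ℤ[√m] {m} m≢1 a b c d rewrite m≢1 = cong (a * c + + m * (b * d) ,_) (+-identityʳ (a * d + b * c))

norm-mulO : ∀ {m} → (m ℕ.% 4 ℕ.≡ᵇ 1) ≡ false → ∀ z w →
            norm (+ m) (mulO m z w) ≡ norm (+ m) z * norm (+ m) w
norm-mulO {m} m≢1 (a , b) (c , d) =
  trans (cong (norm (+ m)) (mulO-ℤ[√m] {m} m≢1 a b c d)) (norm-* (+ m) a b c d)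

generator-∈ : ∀ {m} → (m ℕ.% 4 ℕ.≡ᵇ 1) ≡ false → (I : Ideal m) (P : Principal I) → mem I (proj₁ P)
generator-∈ {m} m≢1 I ((p , q) , generates) = proj₂ (generates (p , q)) ((+ 1 , + 0) , sym 1·g≡g)
  where
  1·g≡g : mulO m (+ 1 , + 0) (p , q) ≡ (p , q)
  1·g≡g = trans (mulO-ℤ[√m] {m} m≢1 (+ 1) (+ 0) p q) (cong₂ _,_
    (trans (cong (λ t → + 1 * p + t) (*-zeroʳ (+ m))) (trans (+-identityʳ (+ 1 * p)) (*-identityˡ p)))
    (trans (+-identityʳ (+ 1 * q)) (*-identityˡ q)))

norm-generator-∣ : ∀ {m} → (m ℕ.% 4 ℕ.≡ᵇ 1) ≡ false → (I : Ideal m) (P : Principal I) →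
                   ∀ {z} → mem I z → norm (+ m) (proj₁ P) ∣ norm (+ m) z
norm-generator-∣ {m} m≢1 I (g , generates) z∈I with proj₁ (generates _) z∈I
... | r , refl = divides (norm (+ m) r) (norm-mulO {m} m≢1 r g)

module _ (k : ℕ) where
  private
    A : ℕ
    A = 7 ℕ.* ℕ.suc k
    m : ℕ
    m = A ℕ.* A ℕ.+ 2
    c : ℤ
    c = + ℕ.suc k
    m≢1 : (m ℕ.% 4 ℕ.≡ᵇ 1) ≡ false
    m≢1 = n*n+2%4≢1 A
    +m≡ : + m ≡ (+ 7 * c) * (+ 7 * c) + + 2
    +m≡ = trans (+[n*n+2] A) (cong (λ a → a * a + + 2) (pos-* 7 (ℕ.suc k)))

  -- The ideal (7, 3 + √m): the kernel of ℤ[√m] → 𝔽₇, √m ↦ 3.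
  In𝔭₇ : O m → Set
  In𝔭₇ (x , y) = + 7 ∣ x - + 3 * y

  In𝔭₇-+ : ∀ z w → In𝔭₇ z → In𝔭₇ w → In𝔭₇ (addO m z w)
  In𝔭₇-+ (x₁ , y₁) (x₂ , y₂) 7∣₁ 7∣₂ = subst (+ 7 ∣_) (regroup x₁ y₁ x₂ y₂) (∣m∣n⇒∣m+n 7∣₁ 7∣₂)
    where
    regroup : ∀ x₁ y₁ x₂ y₂ → (x₁ - + 3 * y₁) + (x₂ - + 3 * y₂) ≡ (x₁ + x₂) - + 3 * (y₁ + y₂)
    regroup = solve-∀

  In𝔭₇-* : ∀ r z → In𝔭₇ z → In𝔭₇ (mulO m r z)
  In𝔭₇-* (u , v) (x , y) 7∣x-3y = subst In𝔭₇ (sym (mulO-ℤ[√m] {m} m≢1 u v x y))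
    (subst (+ 7 ∣_) (sym regroup)
      (∣m∣n⇒∣m+n (∣n⇒∣m*n (u - + 3 * v) 7∣x-3y) (∣m⇒∣m*n (v * y * (+ 7 * c * c - + 1)) ∣-refl)))
    where
    regroup : (u * x + + m * (v * y)) - + 3 * (u * y + v * x)
              ≡ (u - + 3 * v) * (x - + 3 * y) + + 7 * (v * y * (+ 7 * c * c - + 1))
    regroup rewrite +m≡ = identity c u v x y
      where
      identity : ∀ c u v x y → (u * x + ((+ 7 * c) * (+ 7 * c) + + 2) * (v * y)) - + 3 * (u * y + v * x)
                               ≡ (u - + 3 * v) * (x - + 3 * y) + + 7 * (v * y * (+ 7 * c * c - + 1))
      identity = solve-∀

  𝔭₇ : Ideal m
  𝔭₇ = record { mem = In𝔭₇ ; has-zero = divides (+ 0) refl ; add-closed = In𝔭₇-+ ; mul-closed = In𝔭₇-* }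

  7∣norm : ∀ z → In𝔭₇ z → + 7 ∣ norm (+ m) z
  7∣norm (p , q) 7∣p-3q = subst (+ 7 ∣_) (sym factor)
    (∣m∣n⇒∣m+n (∣m⇒∣m*n (p + + 3 * q) 7∣p-3q) (∣m⇒∣m*n (q * q * (+ 1 - + 7 * c * c)) ∣-refl))
    where
    factor : norm (+ m) (p , q) ≡ (p - + 3 * q) * (p + + 3 * q) + + 7 * (q * q * (+ 1 - + 7 * c * c))
    factor rewrite +m≡ = identity c p q
      where
      identity : ∀ c p q → p * p - ((+ 7 * c) * (+ 7 * c) + + 2) * (q * q)
                           ≡ (p - + 3 * q) * (p + + 3 * q) + + 7 * (q * q * (+ 1 - + 7 * c * c))
      identity = solve-∀

  norm-generator-∣7 : (P : Principal 𝔭₇) → norm (+ m) (proj₁ P) ∣ + 7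
  norm-generator-∣7 P = subst (norm (+ m) (proj₁ P) ∣_) combination
    (∣m∣n⇒∣m+n (∣n⇒∣m*n (c * c) (norm-generator-∣ m≢1 𝔭₇ P {+ 7 , + 0} (divides (+ 1) refl)))
               (norm-generator-∣ m≢1 𝔭₇ P {+ 3 , + 1} (divides (+ 0) refl)))
    where
    combination : c * c * norm (+ m) (+ 7 , + 0) + norm (+ m) (+ 3 , + 1) ≡ + 7
    combination rewrite +m≡ = identity c
      where
      identity : ∀ c → c * c * (+ 7 * + 7 - ((+ 7 * c) * (+ 7 * c) + + 2) * (+ 0 * + 0))
                       + (+ 3 * + 3 - ((+ 7 * c) * (+ 7 * c) + + 2) * (+ 1 * + 1)) ≡ + 7
      identity = solve-∀

  𝔭₇-nonprincipal : ¬ Principal 𝔭₇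
  𝔭₇-nonprincipal P = ∣norm∣≢7 5≤A (proj₁ P)
    (ℕ.∣-antisym (∣⇒∣ᵤ (norm-generator-∣7 P)) (∣⇒∣ᵤ (7∣norm (proj₁ P) (generator-∈ m≢1 𝔭₇ P))))
    where
    5≤A : 5 ℕ.≤ A
    5≤A = ℕ.≤-trans (ℕ.m≤m+n 5 2) (ℕ.m≤m*n 7 (ℕ.suc k))

  h[49[1+k]²+2]>1 : ClassNumberGT1 m
  h[49[1+k]²+2]>1 = 𝔭₇ , ((+ 7 , + 0) , divides (+ 1) refl , λ ()) , 𝔭₇-nonprincipal

proposition2p1 : (n : ℕ) → n ≥ 1 → SquareFree (mOf n) → ClassNumberGT1 (mOf n)
proposition2p1 n _ _ = subst ClassNumberGT1 (sym (mOf≡[7[4n+2]]²+2 n)) (h[49[1+k]²+2]>1 (4 ℕ.* n ℕ.+ 1))
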